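{- Let $\mathbf{x}=(x_1,\dots,x_m)$ and $\mathbf{y}=(y_1,\dots,y_n)$ be backbones, let $\mathrm{M}$ be their $(m+1)\times(n+1)$ alignment matrix, and let $\alpha$ be an alignment found from backtracking. Then $\alpha$ is an alignment of $\mathbf{x}$ and $\mathbf{y}$.
   Context: A backbone is a finite sequence of pairs $x_i=(s_{\mathbf{x},i},w_{\mathbf{x},i})$, $s$ a string, $w\ge0$. Empty node $\mathbf{0}=(0,0)$, $\tilde{\mathbf{x}}=\{\mathbf{0}\}\cup\mathbf{x}$ (entries distinct, index $\iota(x_i)=i$). An alignment of $\mathbf{x},\mathbf{y}$ is a map $\alpha:[k]\to\tilde{\mathbf{x}}\times\tilde{\mathbf{y}}$, $\alpha(i)=(\alpha_{\mathbf{x}}(i),\alpha_{\mathbf{y}}(i))$, such that $(\mathbf{0},\mathbf{0})$ is not in the image; for non-empty $\alpha_{\mathbf{x}}(i),\alpha_{\mathbf{x}}(j)$, $\iota(\alpha_{\mathbf{x}}(i))<\iota(\alpha_{\mathbf{x}}(j))$ iff $i<j$, likewise for $\mathbf{y}$; each image pair has equal strings or contains $\mathbf{0}$; each node of $\mathbf{x}$, resp. $\mathbf{y}$, occurs exactly once in the respective coordinate. Alignment matrix: $\mathrm{M}[1,1]=0$, $\mathrm{M}[i,1]=\sum_{k=1}^{i-1}w_{\mathbf{x},k}$ ($i>1$), $\mathrm{M}[1,j]=\sum_{k=1}^{j-1}w_{\mathbf{y},k}$ ($j>1$), otherwise $\mathrm{M}[i,j]=\min\{\mathrm{M}[i-1,j]+w_{\mathbf{x},i-1},\mathrm{M}[i,j-1]+w_{\mathbf{y},j-1},\mathrm{M}[i-1,j-1]+\mathrm{diff}(x_{i-1},y_{j-1})\}$,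 where $\mathrm{diff}((s_x,w_x),(s_y,w_y))=|w_x-w_y|$ if $s_x=s_y$ and $\infty$ otherwise. Backtracking: a path $p$ of matrix positions with $p(1)=(m+1,n+1)$ and, if $p(h)=(i,j)$, $p(h+1)$ is one of $(i-1,j)$ if $\mathrm{M}[i,j]=\mathrm{M}[i-1,j]+w_{\mathbf{x},i-1}$, $(i,j-1)$ if $\mathrm{M}[i,j]=\mathrm{M}[i,j-1]+w_{\mathbf{y},j-1}$, or $(i-1,j-1)$ if $\mathrm{M}[i,j]=\mathrm{M}[i-1,j-1]+\mathrm{diff}(x_{i-1},y_{j-1})$ (any one if several hold), continuing until $(1,1)$ (with only the valid boundary moves $(i-1,1)$ or $(1,j-1)$ on the first column/row); say $p$ has $K$ positions. Let $p'$ be the reversed path (from $(1,1)$ to $(m+1,n+1)$). The alignment found from backtracking is $\alpha:[K-1]\to\tilde{\mathbf{x}}\times\tilde{\mathbf{y}}$ with $\alpha(h)=(x_i,\mathbf{0})$ if $p'(h)=(i,j)$, $p'(h+1)=(i+1,j)$; $\alpha(h)=(\mathbf{0},y_j)$ if $p'(h)=(i,j)$, $p'(h+1)=(i,j+1)$; $\alpha(h)=(x_i,y_j)$ if $p'(h)=(i,j)$, $p'(h+1)=(i+1,j+1)$. -}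

module Defs where

open import Data.Nat using (ℕ; zero; suc)
open import Data.Fin using (Fin; zero; suc; toℕ; inject₁; fromℕ; _<_)
open import Data.Vec using (Vec; []; _∷_; lookup)
open import Data.List using (List; []; _∷_; _++_; [_]; length)
open import Data.Maybe using (Maybe; just; nothing)
open import Data.Product using (_×_; _,_; proj₁; proj₂; Σ; ∃)
open import Data.String using (String; _≟_)
open import Data.Rational using (ℚ; 0ℚ; _+_; _-_; ∣_∣; _⊓_; _≤_)
open import Relation.Nullary using (¬_; yes; no)
open import Relation.Binary.PropositionalEquality using (_≡_; _≢_)

Node : Set
Node = String × ℚ

str : Node → String
str = proj₁

wt : Node → ℚ
wt = proj₂

Backbone : ℕ → Set
Backbone m = Vec Node m

NonNegWeights : ∀ {m} → Backbone m → Set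
NonNegWeights {m} x = (i : Fin m) → 0ℚ ≤ wt (lookup x i)

-- Elements of x̃ = {0} ∪ x are represented as Maybe (Fin m):
-- nothing is the empty node 0, just i is the node x_{i+1}
-- (0-based index, so ι(x_{i+1}) = i + 1 corresponds to toℕ i).

data ℚ∞ : Set where
  fin : ℚ → ℚ∞
  ∞   : ℚ∞

_⊕_ : ℚ∞ → ℚ∞ → ℚ∞
fin a ⊕ fin b = fin (a + b)
fin a ⊕ ∞     = ∞
∞     ⊕ _     = ∞

min∞ : ℚ∞ → ℚ∞ → ℚ∞
min∞ (fin a) (fin b) = fin (a ⊓ b)
min∞ (fin a) ∞       = fin a
min∞ ∞       b       = b

diff : Node → Node → ℚ∞
diff a b with str a ≟ str b
... | yes _ = fin ∣ wt a - wt b ∣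
... | no  _ = ∞

-- Total lookups by natural-number index (used only inside the range)

wAt : ∀ {m} → Backbone m → ℕ → ℚ
wAt []      _       = 0ℚ
wAt (a ∷ _) zero    = wt a
wAt (_ ∷ x) (suc k) = wAt x k

diffAt : ∀ {m n} → Backbone m → Backbone n → ℕ → ℕ → ℚ∞
diffAt []      _       _       _       = ∞
diffAt (_ ∷ _) []      _       _       = ∞
diffAt (a ∷ _) (b ∷ _) zero    zero    = diff a b
diffAt (a ∷ x) (b ∷ y) zero    (suc l) = diffAt (a ∷ x) y zero l
diffAt (a ∷ x) y       (suc k) l       = diffAt x y k l

psum : (ℕ → ℚ) → ℕ → ℚ
psum f zero    = 0ℚ
psum f (suc i) = psum f i + f i

-- Alignment matrix, 0-based: Mat x y i j = M[i+1, j+1] of the paper.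

Mat : ∀ {m n} → Backbone m → Backbone n → ℕ → ℕ → ℚ∞
Mat x y i       zero    = fin (psum (wAt x) i)
Mat x y zero    (suc j) = fin (psum (wAt y) (suc j))
Mat x y (suc i) (suc j) =
  min∞ (min∞ (Mat x y i (suc j) ⊕ fin (wAt x i))
             (Mat x y (suc i) j ⊕ fin (wAt y j)))
       (Mat x y i j ⊕ diffAt x y i j)

data BPath {m n} (x : Backbone m) (y : Backbone n) : Fin (suc m) → Fin (suc n) → Set where
  done : BPath x y zero zero
  up   : ∀ {i : Fin m} {j : Fin (suc n)} →
         Mat x y (suc (toℕ i)) (toℕ j) ≡ Mat x y (toℕ i) (toℕ j) ⊕ fin (wAt x (toℕ i)) →
         BPath x y (inject₁ i) j → BPath x y (suc i) j
  left : ∀ {i : Fin (suc m)} {j : Fin n} →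
         Mat x y (toℕ i) (suc (toℕ j)) ≡ Mat x y (toℕ i) (toℕ j) ⊕ fin (wAt y (toℕ j)) →
         BPath x y i (inject₁ j) → BPath x y i (suc j)
  diag : ∀ {i : Fin m} {j : Fin n} →
         Mat x y (suc (toℕ i)) (suc (toℕ j)) ≡ Mat x y (toℕ i) (toℕ j) ⊕ diffAt x y (toℕ i) (toℕ j) →
         BPath x y (inject₁ i) (inject₁ j) → BPath x y (suc i) (suc j)

-- The alignment read off the reversed path p' (as a list α(1), …, α(K-1)).
alignList : ∀ {m n} {x : Backbone m} {y : Backbone n} {i j} →
            BPath x y i j → List (Maybe (Fin m) × Maybe (Fin n))
alignList done                 = []
alignList (up   {i = i} _ p)   = alignList p ++ [ (just i , nothing) ]
alignList (left {j = j} _ p)   = alignList p ++ [ (nothing , just j) ]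
alignList (diag {i = i} {j = j} _ p) = alignList p ++ [ (just i , just j) ]

record IsAlignment {m n} (x : Backbone m) (y : Backbone n) {k : ℕ}
                   (α : Fin k → Maybe (Fin m) × Maybe (Fin n)) : Set where
  field
    noEmpty : ∀ h → α h ≢ (nothing , nothing)
    orderX  : ∀ h h' a b → proj₁ (α h) ≡ just a → proj₁ (α h') ≡ just b →
              (a < b → h < h') × (h < h' → a < b)
    orderY  : ∀ h h' a b → proj₂ (α h) ≡ just a → proj₂ (α h') ≡ just b →
              (a < b → h < h') × (h < h' → a < b)
    match   : ∀ h a b → α h ≡ (just a , just b) → str (lookup x a) ≡ str (lookup y b)
    onceX   : ∀ (a : Fin m) → Σ (Fin k) (λ h → proj₁ (α h) ≡ just a)
    uniqX   : ∀ (a : Fin m) h h' → proj₁ (α h) ≡ just a → proj₁ (α h') ≡ just a → h ≡ h'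
    onceY   : ∀ (b : Fin n) → Σ (Fin k) (λ h → proj₂ (α h) ≡ just b)
    uniqY   : ∀ (b : Fin n) h h' → proj₂ (α h) ≡ just b → proj₂ (α h') ≡ just b → h ≡ h'

-- Reading the backtracking path forwards, every step appends one pair to the
-- alignment: (x_i, 0) for a vertical step, (0, y_j) for a horizontal one and
-- (x_i, y_j) for a diagonal one.  Hence, along a path from (1,1) to (i+1,j+1),
-- the non-empty first coordinates are exactly x_1, …, x_i in increasing order,
-- and likewise for y; order preservation, existence and uniqueness all follow
-- from this.  A diagonal step requires M[i,j] = M[i-1,j-1] + diff(x_{i-1}, y_{j-1});
-- as every matrix entry is finite, so is this diff, i.e. the two strings agree.
module Submission where

open import Defs
open import Data.Nat using (ℕ)
open import Data.Fin using (fromℕ)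
open import Data.List using (lookup)

import Data.Nat as ℕ
open import Data.Nat.Properties using (<-cmp; <-irrefl; <-asym; <-trans; n<1+n; ≤-pred; m≤n⇒m<n∨m≡n)
open import Data.Fin as Fin using (Fin; toℕ)
open import Data.Fin.Properties using (toℕ<n; toℕ-injective; toℕ-fromℕ; toℕ-inject₁)
open import Data.Vec as Vec using ()
open import Data.List using (List; []; _∷_; _∷ʳ_; length)
open import Data.List.Relation.Unary.All as All using (All)
open import Data.List.Relation.Unary.All.Properties using (∷ʳ⁺)
open import Data.List.Membership.Propositional.Properties using (∈-lookup)
open import Data.Maybe using (Maybe; just; nothing)
open import Data.Product using (_×_; _,_; proj₁; proj₂; Σ; ∃₂)
open import Data.Sum using (_⊎_; inj₁; inj₂)
open import Data.Empty using (⊥; ⊥-elim)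
open import Data.String using (_≟_)
open import Relation.Nullary using (yes; no)
open import Relation.Binary.Definitions using (tri<; tri≈; tri>)
open import Relation.Binary.PropositionalEquality using (_≡_; _≢_; refl; sym; trans; cong; subst)

data EntryAt {B : Set} : List B → ℕ → B → Set where
  here  : ∀ {b L} → EntryAt (b ∷ L) 0 b
  there : ∀ {b c L n} → EntryAt L n b → EntryAt (c ∷ L) (ℕ.suc n) b

module _ {B : Set} where

  entryAt-bound : ∀ {L : List B} {n b} → EntryAt L n b → n ℕ.< length L
  entryAt-bound here      = ℕ.s≤s ℕ.z≤n
  entryAt-bound (there e) = ℕ.s≤s (entryAt-bound e)

  entryAt-functional : ∀ {L : List B} {n b c} → EntryAt L n b → EntryAt L n c → b ≡ c
  entryAt-functional here      here       = refl
  entryAt-functional (there e) (there e') = entryAt-functional e e'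

  entryAt-∷ʳ⁺ : ∀ {L : List B} {n b} e → EntryAt L n b → EntryAt (L ∷ʳ e) n b
  entryAt-∷ʳ⁺ e here      = here
  entryAt-∷ʳ⁺ e (there d) = there (entryAt-∷ʳ⁺ e d)

  entryAt-last : ∀ (L : List B) e → EntryAt (L ∷ʳ e) (length L) e
  entryAt-last []      e = here
  entryAt-last (_ ∷ L) e = there (entryAt-last L e)

  entryAt-∷ʳ⁻ : ∀ (L : List B) {e n b} → EntryAt (L ∷ʳ e) n b →
                EntryAt L n b ⊎ (n ≡ length L × b ≡ e)
  entryAt-∷ʳ⁻ []      here      = inj₂ (refl , refl)
  entryAt-∷ʳ⁻ (_ ∷ L) here      = inj₁ here
  entryAt-∷ʳ⁻ (_ ∷ L) (there d) with entryAt-∷ʳ⁻ L d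
  ... | inj₁ d′        = inj₁ (there d′)
  ... | inj₂ (n≡ , b≡) = inj₂ (cong ℕ.suc n≡ , b≡)

  entryAt-lookup : ∀ (L : List B) (h : Fin (length L)) → EntryAt L (toℕ h) (lookup L h)
  entryAt-lookup (_ ∷ L) Fin.zero    = here
  entryAt-lookup (_ ∷ L) (Fin.suc h) = there (entryAt-lookup L h)

  entryAt⇒lookup : ∀ {L : List B} {n b} → EntryAt L n b → Σ (Fin (length L)) (λ h → lookup L h ≡ b)
  entryAt⇒lookup here      = Fin.zero , refl
  entryAt⇒lookup (there d) with entryAt⇒lookup d
  ... | h , eq = Fin.suc h , eq

data Enumerates {B : Set} {m : ℕ} (f : B → Maybe (Fin m)) : List B → ℕ → Set where
  []   : Enumerates f [] 0
  skip : ∀ {L k e} → Enumerates f L k → f e ≡ nothing → Enumerates f (L ∷ʳ e) k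
  next : ∀ {L k e a} → Enumerates f L k → f e ≡ just a → toℕ a ≡ k →
         Enumerates f (L ∷ʳ e) (ℕ.suc (toℕ a))

module _ {B : Set} {m : ℕ} (f : B → Maybe (Fin m)) where

  private
    just≢nothing : ∀ {c a} → f c ≡ just a → f c ≡ nothing → ⊥
    just≢nothing fc≡a fc≡∅ with trans (sym fc≡a) fc≡∅
    ... | ()

    just-injective : ∀ {c a b} → f c ≡ just a → f c ≡ just b → a ≡ b
    just-injective fc≡a fc≡b with trans (sym fc≡a) fc≡b
    ... | refl = refl

  enumerates-bound : ∀ {L k p c a} → Enumerates f L k → EntryAt L p c → f c ≡ just a → toℕ a ℕ.< k
  enumerates-bound (skip {L} E fe≡∅) d fc with entryAt-∷ʳ⁻ L d
  ... | inj₁ d′         = enumerates-bound E d′ fc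
  ... | inj₂ (_ , refl) = ⊥-elim (just≢nothing fc fe≡∅)
  enumerates-bound (next {L} {k} E fe a≡k) d fc with entryAt-∷ʳ⁻ L d
  ... | inj₁ d′         = <-trans (enumerates-bound E d′ fc) (subst (k ℕ.<_) (cong ℕ.suc (sym a≡k)) (n<1+n k))
  ... | inj₂ (_ , refl) rewrite just-injective fc fe = n<1+n _

  enumerates-increasing : ∀ {L k p p′ c c′ a b} → Enumerates f L k →
                          EntryAt L p c → EntryAt L p′ c′ → f c ≡ just a → f c′ ≡ just b →
                          p ℕ.< p′ → toℕ a ℕ.< toℕ b
  enumerates-increasing (skip {L} E fe≡∅) d d′ fc fc′ p<p′ with entryAt-∷ʳ⁻ L d | entryAt-∷ʳ⁻ L d′
  ... | inj₁ d₁         | inj₁ d₁′        = enumerates-increasing E d₁ d₁′ fc fc′ p<p′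
  ... | _               | inj₂ (_ , refl) = ⊥-elim (just≢nothing fc′ fe≡∅)
  ... | inj₂ (_ , refl) | inj₁ _          = ⊥-elim (just≢nothing fc fe≡∅)
  enumerates-increasing (next {L} E fe a≡k) d d′ fc fc′ p<p′ with entryAt-∷ʳ⁻ L d | entryAt-∷ʳ⁻ L d′
  ... | inj₁ d₁         | inj₁ d₁′        = enumerates-increasing E d₁ d₁′ fc fc′ p<p′
  ... | inj₁ d₁         | inj₂ (_ , refl) rewrite just-injective fc′ fe | a≡k = enumerates-bound E d₁ fc
  ... | inj₂ (refl , _) | inj₁ d₁′        = ⊥-elim (<-asym p<p′ (entryAt-bound d₁′))
  ... | inj₂ (refl , _) | inj₂ (refl , _) = ⊥-elim (<-irrefl refl p<p′)

  enumerates-complete : ∀ {L k} → Enumerates f L k → ∀ a → toℕ a ℕ.< k →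
                        ∃₂ λ p c → EntryAt L p c × f c ≡ just a
  enumerates-complete (skip {L} {e = e} E _) a a<k with enumerates-complete E a a<k
  ... | p , c , d , fc = p , c , entryAt-∷ʳ⁺ e d , fc
  enumerates-complete (next {L} {e = e} {a₀} E fe a₀≡k) a a<k with m≤n⇒m<n∨m≡n (≤-pred a<k)
  ... | inj₁ a<a₀ with enumerates-complete E a (subst (toℕ a ℕ.<_) a₀≡k a<a₀)
  ...   | p , c , d , fc = p , c , entryAt-∷ʳ⁺ e d , fc
  enumerates-complete (next {L} {e = e} E fe _) a _ | inj₂ a≡a₀ rewrite toℕ-injective a≡a₀ =
    length L , e , entryAt-last L e , fe

  module _ {L : List B} {k : ℕ} (E : Enumerates f L k) where

    private
      entry : ∀ h → EntryAt L (toℕ h) (lookup L h)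
      entry = entryAt-lookup L

    enumerates-order : ∀ h h′ a b → f (lookup L h) ≡ just a → f (lookup L h′) ≡ just b →
                       (a Fin.< b → h Fin.< h′) × (h Fin.< h′ → a Fin.< b)
    enumerates-order h h′ a b fa fb = reflects , increasing
      where
        increasing : h Fin.< h′ → a Fin.< b
        increasing = enumerates-increasing E (entry h) (entry h′) fa fb

        reflects : a Fin.< b → h Fin.< h′
        reflects a<b with <-cmp (toℕ h) (toℕ h′)
        ... | tri< h<h′ _ _ = h<h′
        ... | tri≈ _ h≡h′ _ rewrite toℕ-injective h≡h′ = ⊥-elim (<-irrefl (cong toℕ (just-injective fa fb)) a<b)
        ... | tri> _ _ h′<h = ⊥-elim (<-asym a<b (enumerates-increasing E (entry h′) (entry h) fb fa h′<h))

    enumerates-unique : ∀ a h h′ → f (lookup L h) ≡ just a → f (lookup L h′) ≡ just a → h ≡ h′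
    enumerates-unique a h h′ fa fa′ with <-cmp (toℕ h) (toℕ h′)
    ... | tri< h<h′ _ _ = ⊥-elim (<-irrefl refl (enumerates-increasing E (entry h) (entry h′) fa fa′ h<h′))
    ... | tri≈ _ h≡h′ _ = toℕ-injective h≡h′
    ... | tri> _ _ h′<h = ⊥-elim (<-irrefl refl (enumerates-increasing E (entry h′) (entry h) fa′ fa h′<h))

  enumerates-exists : ∀ {L} → Enumerates f L m → ∀ a → Σ (Fin (length L)) (λ h → f (lookup L h) ≡ just a)
  enumerates-exists E a with enumerates-complete E a (toℕ<n a)
  ... | _ , _ , d , fc with entryAt⇒lookup d
  ...   | h , refl = h , fc

data Finite : ℚ∞ → Set where
  finite : ∀ q → Finite (fin q)

min∞-finiteˡ : ∀ {a} b → Finite a → Finite (min∞ a b)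
min∞-finiteˡ (fin _) (finite _) = finite _
min∞-finiteˡ ∞       (finite _) = finite _

⊕-finite : ∀ {a} q → Finite a → Finite (a ⊕ fin q)
⊕-finite q (finite _) = finite _

⊕-finiteʳ : ∀ a d → Finite (a ⊕ d) → Finite d
⊕-finiteʳ (fin _) (fin _) _ = finite _

Mat-finite : ∀ {m n} (x : Backbone m) (y : Backbone n) i j → Finite (Mat x y i j)
Mat-finite x y i           ℕ.zero      = finite _
Mat-finite x y ℕ.zero      (ℕ.suc j)   = finite _
Mat-finite x y (ℕ.suc i)   (ℕ.suc j)   =
  min∞-finiteˡ _ (min∞-finiteˡ _ (⊕-finite _ (Mat-finite x y i (ℕ.suc j))))

diffAt-lookup : ∀ {m n} (x : Backbone m) (y : Backbone n) (i : Fin m) (j : Fin n) →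
                diffAt x y (toℕ i) (toℕ j) ≡ diff (Vec.lookup x i) (Vec.lookup y j)
diffAt-lookup (a Vec.∷ x) (b Vec.∷ y) Fin.zero    Fin.zero    = refl
diffAt-lookup (a Vec.∷ x) (b Vec.∷ y) Fin.zero    (Fin.suc j) = diffAt-lookup (a Vec.∷ x) y Fin.zero j
diffAt-lookup (a Vec.∷ x) (b Vec.∷ y) (Fin.suc i) j           = diffAt-lookup x (b Vec.∷ y) i j

diff-finite⇒str≡ : ∀ a b → Finite (diff a b) → str a ≡ str b
diff-finite⇒str≡ a b _ with str a ≟ str b
diff-finite⇒str≡ a b _  | yes eq = eq
diff-finite⇒str≡ a b () | no _

diagonalStep⇒str≡ : ∀ {m n} (x : Backbone m) (y : Backbone n) (i : Fin m) (j : Fin n) →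
  Mat x y (ℕ.suc (toℕ i)) (ℕ.suc (toℕ j)) ≡ Mat x y (toℕ i) (toℕ j) ⊕ diffAt x y (toℕ i) (toℕ j) →
  str (Vec.lookup x i) ≡ str (Vec.lookup y j)
diagonalStep⇒str≡ x y i j step =
  diff-finite⇒str≡ _ _ (subst Finite (diffAt-lookup x y i j)
    (⊕-finiteʳ (Mat x y (toℕ i) (toℕ j)) _ (subst Finite step (Mat-finite x y (ℕ.suc (toℕ i)) (ℕ.suc (toℕ j))))))

data Admissible {m n} (x : Backbone m) (y : Backbone n) : Maybe (Fin m) × Maybe (Fin n) → Set where
  onlyˣ   : ∀ a → Admissible x y (just a , nothing)
  onlyʸ   : ∀ b → Admissible x y (nothing , just b)
  matched : ∀ {a b} → str (Vec.lookup x a) ≡ str (Vec.lookup y b) → Admissible x y (just a , just b)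

module _ {m n} {x : Backbone m} {y : Backbone n} where

  admissible-nonEmpty : ∀ {e} → Admissible x y e → e ≢ (nothing , nothing)
  admissible-nonEmpty (onlyˣ _)   ()
  admissible-nonEmpty (onlyʸ _)   ()
  admissible-nonEmpty (matched _) ()

  admissible-str≡ : ∀ {a b} → Admissible x y (just a , just b) → str (Vec.lookup x a) ≡ str (Vec.lookup y b)
  admissible-str≡ (matched eq) = eq

  alignList-admissible : ∀ {i j} (p : BPath x y i j) → All (Admissible x y) (alignList p)
  alignList-admissible done                       = All.[]
  alignList-admissible (up {i = i} _ p)           = ∷ʳ⁺ (alignList-admissible p) (onlyˣ i)
  alignList-admissible (left {j = j} _ p)         = ∷ʳ⁺ (alignList-admissible p) (onlyʸ j)
  alignList-admissible (diag {i = i} {j} step p)  =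
    ∷ʳ⁺ (alignList-admissible p) (matched (diagonalStep⇒str≡ x y i j step))

  alignList-enumeratesˣ : ∀ {i j} (p : BPath x y i j) → Enumerates proj₁ (alignList p) (toℕ i)
  alignList-enumeratesˣ done                 = []
  alignList-enumeratesˣ (up {i = i} _ p)     = next (alignList-enumeratesˣ p) refl (sym (toℕ-inject₁ i))
  alignList-enumeratesˣ (left _ p)           = skip (alignList-enumeratesˣ p) refl
  alignList-enumeratesˣ (diag {i = i} _ p)   = next (alignList-enumeratesˣ p) refl (sym (toℕ-inject₁ i))

  alignList-enumeratesʸ : ∀ {i j} (p : BPath x y i j) → Enumerates proj₂ (alignList p) (toℕ j)
  alignList-enumeratesʸ done                 = []
  alignList-enumeratesʸ (up _ p)             = skip (alignList-enumeratesʸ p) refl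
  alignList-enumeratesʸ (left {j = j} _ p)   = next (alignList-enumeratesʸ p) refl (sym (toℕ-inject₁ j))
  alignList-enumeratesʸ (diag {j = j} _ p)   = next (alignList-enumeratesʸ p) refl (sym (toℕ-inject₁ j))

mainTheorem14 : ∀ {m n : ℕ} (x : Backbone m) (y : Backbone n) →
    NonNegWeights x → NonNegWeights y →
    (p : BPath x y (fromℕ m) (fromℕ n)) →
    IsAlignment x y (lookup (alignList p))
mainTheorem14 {m} {n} x y _ _ p = record
  { noEmpty = λ h → admissible-nonEmpty (admissible h)
  ; orderX  = enumerates-order proj₁ enumˣ
  ; orderY  = enumerates-order proj₂ enumʸ
  ; match   = λ h a b αh≡ → admissible-str≡ (subst (Admissible x y) αh≡ (admissible h))
  ; onceX   = enumerates-exists proj₁ enumˣ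
  ; uniqX   = enumerates-unique proj₁ enumˣ
  ; onceY   = enumerates-exists proj₂ enumʸ
  ; uniqY   = enumerates-unique proj₂ enumʸ
  }
  where
    admissible : ∀ h → Admissible x y (lookup (alignList p) h)
    admissible h = All.lookup (alignList-admissible p) (∈-lookup h)

    enumˣ : Enumerates proj₁ (alignList p) m
    enumˣ = subst (Enumerates proj₁ _) (toℕ-fromℕ m) (alignList-enumeratesˣ p)

    enumʸ : Enumerates proj₂ (alignList p) n
    enumʸ = subst (Enumerates proj₂ _) (toℕ-fromℕ n) (alignList-enumeratesʸ p)
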